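{- No generalized Petersen graph $GP(n,k)$ has cop number $1$. A generalized Petersen graph $GP(n,k)$ can have cop number $2$ only if $k=1$, $n=3k$, or $n=4k$.
   Context: For integers $n\ge 5$ and $1\le k<n/2$, the generalized Petersen graph $GP(n,k)$ has vertex set $\{a_0,\dots,a_{n-1},b_0,\dots,b_{n-1}\}$ and edge set $\{a_ia_{i+1},\ a_ib_i,\ b_ib_{i+k}: 0\le i\le n-1\}$, subscripts modulo $n$. Cops and robbers: cops are placed first, then the robber; players alternate, cops first; each pawn stays or moves to an adjacent vertex (all cops may move on the cops' turn); perfect information; cops win if a cop occupies the robber's vertex in finitely many moves. The cop number is the least number of cops that can guarantee capture. -}

module Defs where

open import Data.Nat using (ℕ; zero; suc; _+_; _<_)
open import Data.Nat.DivMod using (_%_)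
open import Data.Fin using (Fin; toℕ)
open import Data.Bool using (Bool; true; false)
open import Data.Product using (Σ; ∃; _×_; _,_)
open import Data.Sum using (_⊎_)
open import Relation.Binary.PropositionalEquality using (_≡_)
open import Relation.Nullary using (¬_)

-- (a + b) mod n  (the case n = 0 never arises for GP(n,k) with n ≥ 5)
plusMod : ℕ → ℕ → ℕ → ℕ
plusMod zero    a b = a + b
plusMod (suc m) a b = (a + b) % suc m

-- vertices: (false , i) is a_i (outer), (true , i) is b_i (inner)
GPVertex : ℕ → Set
GPVertex n = Bool × Fin n

-- the listed (directed) edge generators a_i a_{i+1}, a_i b_i, b_i b_{i+k}
data GPEdge (n k : ℕ) : GPVertex n → GPVertex n → Set where
  outer : (i j : Fin n) → toℕ j ≡ plusMod n (toℕ i) 1 → GPEdge n k (false , i) (false , j)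
  spoke : (i : Fin n) → GPEdge n k (false , i) (true , i)
  inner : (i j : Fin n) → toℕ j ≡ plusMod n (toℕ i) k → GPEdge n k (true , i) (true , j)

GPAdj : (n k : ℕ) → GPVertex n → GPVertex n → Set
GPAdj n k u v = GPEdge n k u v ⊎ GPEdge n k v u

module CopsAndRobbers (V : Set) (Adj : V → V → Set) where

  Cops : ℕ → Set
  Cops c = Fin c → V

  StepOrStay : V → V → Set
  StepOrStay u v = u ≡ v ⊎ Adj u v

  Caught : {c : ℕ} → Cops c → V → Set
  Caught cs r = ∃ λ i → cs i ≡ r

  -- CopWin cs r : it is the cops' turn, cops at cs, robber at r, and the
  -- cops can force capture in finitely many moves (least fixed point).
  data CopWin {c : ℕ} (cs : Cops c) (r : V) : Set where
    caught : Caught cs r → CopWin cs r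
    move   : (cs' : Cops c) → (∀ i → StepOrStay (cs i) (cs' i)) →
             (Caught cs' r ⊎ (∀ r' → StepOrStay r r' → CopWin cs' r')) →
             CopWin cs r

  -- cops are placed first, then the robber; then cops move first
  CopsCanWin : ℕ → Set
  CopsCanWin c = Σ (Cops c) λ cs → ∀ r → CopWin cs r

  HasCopNumber : ℕ → Set
  HasCopNumber c = CopsCanWin c × (∀ m → m < c → ¬ CopsCanWin m)

GPHasCopNumber : (n k c : ℕ) → Set
GPHasCopNumber n k c = CopsAndRobbers.HasCopNumber (GPVertex n) (GPAdj n k) c

-- On a graph of minimum degree 3 the robber escapes one cop as long as no edge lies in two
-- triangles, and escapes two cops if there are no 3- and 4-cycles, because a cop that is not
-- on the robber's vertex then guards at most one of its neighbours.  In GP(n,k) a short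
-- cycle is a closed walk whose outer steps (±1) and inner steps (±k) cancel modulo n; as
-- 2k < n, a triangle forces n = 3k and a 4-cycle forces k = 1 or n = 4k.  An edge in two
-- triangles would give both, which is impossible for n ≥ 5.
module Submission where

open import Defs
open import Data.Bool using (Bool; true; false; not)
import Data.Bool.Properties as Bool
open import Data.Fin using (Fin; zero; suc; toℕ; fromℕ<)
import Data.Fin.Properties as Fin
open import Data.Nat using (ℕ; zero; suc; _+_; _*_; _∸_; _≤_; _<_; z≤n; s≤s; _≟_; _≤?_; NonZero; >-nonZero)
open import Data.Nat.DivMod using (_%_; %-distribˡ-+; m%n%n≡m%n; [m+n]%n≡m%n; m%n<n; m%n≤n; m<n⇒m%n≡m; m≤n⇒[n∸m]%m≡n%m)
open import Data.Nat.Properties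
open import Algebra.Properties.CommutativeSemigroup +-commutativeSemigroup using (xy∙z≈xz∙y; xy∙z≈x∙zy)
open import Data.Nat.Tactic.RingSolver using (solve-∀)
open import Data.Product using (∃; ∃₂; _×_; _,_; proj₁; proj₂)
open import Data.Product.Properties using (≡-dec)
open import Data.Sum using (_⊎_; inj₁; inj₂; [_,_]; swap)
open import Data.Empty using (⊥; ⊥-elim)
open import Function using (_∘_)
open import Relation.Binary.Definitions using (Decidable; DecidableEquality; Symmetric)
open import Relation.Binary.PropositionalEquality hiding ([_])
open import Relation.Nullary using (¬_; Dec; yes; no; contradiction)
open import Relation.Nullary.Decidable using (True; toWitness; map′; _⊎-dec_)

[m%d+n]%d≡[m+n]%d : ∀ m n d .{{_ : NonZero d}} → (m % d + n) % d ≡ (m + n) % d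
[m%d+n]%d≡[m+n]%d m n d = begin
  (m % d + n) % d          ≡⟨ %-distribˡ-+ (m % d) n d ⟩
  (m % d % d + n % d) % d  ≡⟨ cong (λ x → (x + n % d) % d) (m%n%n≡m%n m d) ⟩
  (m % d + n % d) % d      ≡⟨ sym (%-distribˡ-+ m n d) ⟩
  (m + n) % d              ∎
  where open ≡-Reasoning

+-%-congʳ : ∀ m n o d .{{_ : NonZero d}} → m % d ≡ n % d → (m + o) % d ≡ (n + o) % d
+-%-congʳ m n o d eq = begin
  (m + o) % d      ≡⟨ sym ([m%d+n]%d≡[m+n]%d m o d) ⟩
  (m % d + o) % d  ≡⟨ cong (λ x → (x + o) % d) eq ⟩
  (n % d + o) % d  ≡⟨ [m%d+n]%d≡[m+n]%d n o d ⟩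
  (n + o) % d      ∎
  where open ≡-Reasoning

+-%-cancelˡ : ∀ x m n d .{{_ : NonZero d}} → (x + m) % d ≡ (x + n) % d → m % d ≡ n % d
+-%-cancelˡ x m n d eq = begin
  m % d                        ≡⟨ sym (undo m) ⟩
  ((r + m) % d + (d ∸ r)) % d  ≡⟨ cong (λ y → (y + (d ∸ r)) % d) eq′ ⟩
  ((r + n) % d + (d ∸ r)) % d  ≡⟨ undo n ⟩
  n % d                        ∎
  where
  open ≡-Reasoning
  r : ℕ
  r = x % d
  eq′ : (r + m) % d ≡ (r + n) % d
  eq′ = trans ([m%d+n]%d≡[m+n]%d x m d) (trans eq (sym ([m%d+n]%d≡[m+n]%d x n d)))
  undo : ∀ y → ((r + y) % d + (d ∸ r)) % d ≡ y % d
  undo y = begin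
    ((r + y) % d + (d ∸ r)) % d  ≡⟨ [m%d+n]%d≡[m+n]%d (r + y) (d ∸ r) d ⟩
    (r + y + (d ∸ r)) % d        ≡⟨ cong (_% d) (xy∙z≈xz∙y r y (d ∸ r)) ⟩
    (r + (d ∸ r) + y) % d        ≡⟨ cong (λ z → (z + y) % d) (m+[n∸m]≡n (m%n≤n x d)) ⟩
    (d + y) % d                  ≡⟨ cong (_% d) (+-comm d y) ⟩
    (y + d) % d                  ≡⟨ [m+n]%n≡m%n y d ⟩
    y % d                        ∎

%-injective-< : ∀ {m n} d .{{_ : NonZero d}} → m < d → n < d → m % d ≡ n % d → m ≡ n
%-injective-< d m<d n<d eq = trans (sym (m<n⇒m%n≡m m<d)) (trans eq (m<n⇒m%n≡m n<d))

m%d≡0⇒m≡d : ∀ {m} d .{{_ : NonZero d}} → 0 < m → m < d + d → m % d ≡ 0 → m ≡ d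
m%d≡0⇒m≡d {m} d 0<m m<2d eq with m <? d
... | yes m<d = contradiction (trans (sym (m<n⇒m%n≡m m<d)) eq) (≢-sym (<⇒≢ 0<m))
... | no m≮d = begin
  m          ≡⟨ sym (m∸n+n≡m d≤m) ⟩
  m ∸ d + d  ≡⟨ cong (_+ d) m∸d≡0 ⟩
  d          ∎
  where
  open ≡-Reasoning
  d≤m : d ≤ m
  d≤m = ≮⇒≥ m≮d
  m∸d<d : m ∸ d < d
  m∸d<d = +-cancelʳ-< d (m ∸ d) d (subst (_< d + d) (sym (m∸n+n≡m d≤m)) m<2d)
  m∸d≡0 : m ∸ d ≡ 0
  m∸d≡0 = trans (sym (m<n⇒m%n≡m m∸d<d)) (trans (m≤n⇒[n∸m]%m≡n%m d≤m) eq)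

record ThreeNeighbours {V : Set} (Adj : V → V → Set) (v : V) : Set where
  field
    n₁ n₂ n₃ : V
    adj₁ : Adj v n₁
    adj₂ : Adj v n₂
    adj₃ : Adj v n₃
    n₁≢n₂ : n₁ ≢ n₂
    n₁≢n₃ : n₁ ≢ n₃
    n₂≢n₃ : n₂ ≢ n₃

module Evasion {V : Set} {Adj : V → V → Set}
  (_≟ᵛ_ : DecidableEquality V) (adj? : Decidable Adj)
  (adj-sym : Symmetric Adj) (adj-irrefl : ∀ {v} → ¬ Adj v v)
  (neighbours : ∀ v → ThreeNeighbours Adj v) where

  open CopsAndRobbers V Adj

  TriangleFree : Set
  TriangleFree = ∀ {a b c} → Adj a b → Adj b c → Adj c a → ⊥

  SquareFree : Set
  SquareFree = ∀ {a b c d} → a ≢ c → b ≢ d → Adj a b → Adj b c → Adj c d → Adj d a → ⊥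

  EdgesInAtMostOneTriangle : Set
  EdgesInAtMostOneTriangle = ∀ {r c y z} → Adj r c → Adj r y → Adj c y → Adj r z → Adj c z → y ≡ z

  Unguarded : ∀ {c} → Cops c → V → Set
  Unguarded cs v = ∀ i → ¬ StepOrStay (cs i) v

  Evasive : ℕ → Set
  Evasive c = ∀ (cs : Cops c) r → (∀ i → cs i ≢ r) → ∃ λ r′ → StepOrStay r r′ × Unguarded cs r′

  unguarded⇒¬CopWin : ∀ {c} → Evasive c → ∀ {cs : Cops c} {r} → Unguarded cs r → ¬ CopWin cs r
  unguarded⇒¬CopWin evade safe (caught (i , cᵢ≡r)) = safe i (inj₁ cᵢ≡r)
  unguarded⇒¬CopWin evade safe (move cs′ moves (inj₁ (i , c′ᵢ≡r))) =
    safe i (subst (StepOrStay _) c′ᵢ≡r (moves i))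
  unguarded⇒¬CopWin evade {r = r} safe (move cs′ moves (inj₂ win))
    with evade cs′ r (λ i c′ᵢ≡r → safe i (subst (StepOrStay _) c′ᵢ≡r (moves i)))
  ... | r′ , step , safe′ = unguarded⇒¬CopWin evade safe′ (win r′ step)

  evasive⇒¬CopsCanWin : ∀ {c} → Evasive c → (∀ (cs : Cops c) → ∃ λ r → ∀ i → cs i ≢ r) → ¬ CopsCanWin c
  evasive⇒¬CopsCanWin evade vacant (cs , win) with vacant cs
  ... | r , free with evade cs r free
  ... | r′ , _ , safe = unguarded⇒¬CopWin evade safe (win r′)

  adj⇒≢ : ∀ {u v} → Adj u v → u ≢ v
  adj⇒≢ u~v refl = adj-irrefl u~v

  guards? : ∀ c v → Dec (StepOrStay c v)
  guards? c v = (c ≟ᵛ v) ⊎-dec adj? c v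

  guards⇒adj : ∀ {c v} → StepOrStay c v → v ≢ c → Adj c v
  guards⇒adj (inj₁ c≡v) v≢c = contradiction (sym c≡v) v≢c
  guards⇒adj (inj₂ c~v) _   = c~v

  module _ (u : V) where
    open ThreeNeighbours (neighbours u)

    vacant-vertex : ∀ v → ∃ λ r → u ≢ r × v ≢ r
    vacant-vertex v with v ≟ᵛ n₁
    ... | yes v≡n₁ = n₂ , adj⇒≢ adj₂ , λ v≡n₂ → n₁≢n₂ (trans (sym v≡n₁) v≡n₂)
    ... | no v≢n₁  = n₁ , adj⇒≢ adj₁ , v≢n₁

    two-other-neighbours : ∀ c → ∃₂ λ y z → Adj u y × Adj u z × y ≢ c × z ≢ c × y ≢ z
    two-other-neighbours c with c ≟ᵛ n₁ | c ≟ᵛ n₂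
    ... | yes c≡n₁ | _ = n₂ , n₃ , adj₂ , adj₃ ,
          (λ n₂≡c → n₁≢n₂ (trans (sym c≡n₁) (sym n₂≡c))) , (λ n₃≡c → n₁≢n₃ (trans (sym c≡n₁) (sym n₃≡c))) , n₂≢n₃
    ... | no c≢n₁ | yes c≡n₂ = n₁ , n₃ , adj₁ , adj₃ ,
          (c≢n₁ ∘ sym) , (λ n₃≡c → n₂≢n₃ (trans (sym c≡n₂) (sym n₃≡c))) , n₁≢n₃
    ... | no c≢n₁ | no c≢n₂ = n₁ , n₂ , adj₁ , adj₂ , (c≢n₁ ∘ sym) , (c≢n₂ ∘ sym) , n₁≢n₂

  one-cop-evasive : EdgesInAtMostOneTriangle → Evasive 1
  one-cop-evasive one-triangle cs r free with adj? (cs zero) r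
  ... | no ¬c~r = r , inj₁ refl , λ { zero (inj₁ c≡r) → free zero c≡r ; zero (inj₂ c~r) → ¬c~r c~r }
  ... | yes c~r with two-other-neighbours r (cs zero)
  ... | y , z , r~y , r~z , y≢c , z≢c , y≢z with guards? (cs zero) y | guards? (cs zero) z
  ... | no ¬gy | _      = y , inj₂ r~y , λ { zero → ¬gy }
  ... | yes _  | no ¬gz = z , inj₂ r~z , λ { zero → ¬gz }
  ... | yes gy | yes gz =
    ⊥-elim (y≢z (one-triangle (adj-sym c~r) r~y (guards⇒adj gy y≢c) r~z (guards⇒adj gz z≢c)))

  guards-at-most-one : TriangleFree → SquareFree → ∀ {c r y y′} → c ≢ r → Adj r y → Adj r y′ → y ≢ y′ →
                       StepOrStay c y → StepOrStay c y′ → ⊥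
  guards-at-most-one _ _ _ _ _ y≢y′ (inj₁ c≡y) (inj₁ c≡y′) = y≢y′ (trans (sym c≡y) c≡y′)
  guards-at-most-one no-tri _ _ r~y r~y′ _ (inj₁ refl) (inj₂ y~y′) = no-tri r~y y~y′ (adj-sym r~y′)
  guards-at-most-one no-tri _ _ r~y r~y′ _ (inj₂ y′~y) (inj₁ refl) = no-tri r~y′ y′~y (adj-sym r~y)
  guards-at-most-one _ no-sq c≢r r~y r~y′ y≢y′ (inj₂ c~y) (inj₂ c~y′) =
    no-sq (c≢r ∘ sym) y≢y′ r~y (adj-sym c~y) c~y′ (adj-sym r~y′)

  two-cops-evasive : TriangleFree → SquareFree → Evasive 2
  two-cops-evasive no-tri no-sq cs r free = escape
    where
    open ThreeNeighbours (neighbours r)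
    cop₀ cop₁ : V
    cop₀ = cs zero
    cop₁ = cs (suc zero)
    at-most-one : ∀ i {y y′} → Adj r y → Adj r y′ → y ≢ y′ → StepOrStay (cs i) y → ¬ StepOrStay (cs i) y′
    at-most-one i = guards-at-most-one no-tri no-sq (free i)
    flee : ∀ {y} → Adj r y → ¬ StepOrStay cop₀ y → ¬ StepOrStay cop₁ y →
           ∃ λ r′ → StepOrStay r r′ × Unguarded cs r′
    flee {y} r~y ¬g₀ ¬g₁ = y , inj₂ r~y , λ { zero → ¬g₀ ; (suc zero) → ¬g₁ }
    escape : ∃ λ r′ → StepOrStay r r′ × Unguarded cs r′
    escape with guards? cop₀ n₁ | guards? cop₁ n₁
    ... | no ¬g₀ | no ¬g₁ = flee adj₁ ¬g₀ ¬g₁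
    ... | yes g₀ | _ with guards? cop₁ n₂
    ...   | yes g₁ = flee adj₃ (at-most-one zero adj₁ adj₃ n₁≢n₃ g₀) (at-most-one (suc zero) adj₂ adj₃ n₂≢n₃ g₁)
    ...   | no ¬g₁ = flee adj₂ (at-most-one zero adj₁ adj₂ n₁≢n₂ g₀) ¬g₁
    escape | no _ | yes g₁ with guards? cop₀ n₂
    ...   | yes g₀ = flee adj₃ (at-most-one zero adj₂ adj₃ n₂≢n₃ g₀) (at-most-one (suc zero) adj₁ adj₃ n₁≢n₃ g₁)
    ...   | no ¬g₀ = flee adj₂ ¬g₀ (at-most-one (suc zero) adj₁ adj₂ n₁≢n₂ g₁)

  one-cop-loses : EdgesInAtMostOneTriangle → ¬ CopsCanWin 1
  one-cop-loses one-triangle = evasive⇒¬CopsCanWin (one-cop-evasive one-triangle) vacant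
    where
    vacant : ∀ (cs : Cops 1) → ∃ λ r → ∀ i → cs i ≢ r
    vacant cs with vacant-vertex (cs zero) (cs zero)
    ... | r , c≢r , _ = r , λ { zero → c≢r }

  two-cops-lose : TriangleFree → SquareFree → ¬ CopsCanWin 2
  two-cops-lose no-tri no-sq = evasive⇒¬CopsCanWin (two-cops-evasive no-tri no-sq) vacant
    where
    vacant : ∀ (cs : Cops 2) → ∃ λ r → ∀ i → cs i ≢ r
    vacant cs with vacant-vertex (cs zero) (cs (suc zero))
    ... | r , c₀≢r , c₁≢r = r , λ { zero → c₀≢r ; (suc zero) → c₁≢r }

module GeneralizedPetersen (m k : ℕ) (5≤N : 5 ≤ suc m) (1≤k : 1 ≤ k) (2k<N : 2 * k < suc m) where

  N : ℕ
  N = suc m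

  V : Set
  V = GPVertex N

  Adj : V → V → Set
  Adj = GPAdj N k

  k<N : k < N
  k<N = ≤-<-trans (m≤m+n k (k + 0)) 2k<N

  -- An offset (a , c) counts a outer steps and c inner steps in one direction.
  Offset : Set
  Offset = ℕ × ℕ

  ⟦_⟧ : Offset → ℕ
  ⟦ a , c ⟧ = a + c * k

  _⊕_ : Offset → Offset → Offset
  (a , c) ⊕ (b , d) = a + b , c + d

  ⟦⊕⟧ : ∀ o o′ → ⟦ o ⊕ o′ ⟧ ≡ ⟦ o ⟧ + ⟦ o′ ⟧
  ⟦⊕⟧ (a , c) (b , d) = lemma a b c d k
    where
    lemma : ∀ a b c d k → (a + b) + (c + d) * k ≡ (a + c * k) + (b + d * k)
    lemma = solve-∀

  -- A record rather than an equation, so that the offsets can be recovered by unification.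
  record _≋_ (o o′ : Offset) : Set where
    constructor congruent
    field ⟦⟧-% : ⟦ o ⟧ % N ≡ ⟦ o′ ⟧ % N

  ≋-sym : ∀ {o o′} → o ≋ o′ → o′ ≋ o
  ≋-sym (congruent e) = congruent (sym e)

  numeral-injective : ∀ {a b} {a≤4 : True (a ≤? 4)} {b≤4 : True (b ≤? 4)} → (a , 0) ≋ (b , 0) → a ≡ b
  numeral-injective {a} {b} {a≤4} {b≤4} (congruent e) =
    %-injective-< N (below a≤4) (below b≤4) (subst₂ (λ x y → x % N ≡ y % N) (+-identityʳ a) (+-identityʳ b) e)
    where
    below : ∀ {a} → True (a ≤? 4) → a < N
    below a≤4 = ≤-trans (s≤s (toWitness a≤4)) 5≤N

  multiple-injective : ∀ {c d} {c≤2 : True (c ≤? 2)} {d≤2 : True (d ≤? 2)} → (0 , c) ≋ (0 , d) → c ≡ d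
  multiple-injective {c} {d} {c≤2} {d≤2} (congruent e) =
    *-cancelʳ-≡ c d k {{>-nonZero 1≤k}} (%-injective-< N (below c≤2) (below d≤2) e)
    where
    below : ∀ {c} → True (c ≤? 2) → c * k < N
    below c≤2 = ≤-<-trans (*-monoˡ-≤ k (toWitness c≤2)) 2k<N

  3k≋0⇒N≡3k : (0 , 3) ≋ (0 , 0) → N ≡ 3 * k
  3k≋0⇒N≡3k (congruent e) = sym (m%d≡0⇒m≡d N (≤-trans 1≤k (m≤m+n k _)) (+-mono-< k<N 2k<N) e)

  4k≋0⇒N≡4k : (0 , 4) ≋ (0 , 0) → N ≡ 4 * k
  4k≋0⇒N≡4k (congruent e) = sym (m%d≡0⇒m≡d N (≤-trans 1≤k (m≤m+n k _)) 4k<2N e)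
    where
    4k<2N : 4 * k < N + N
    4k<2N = subst (_< N + N) (sym (*-distribʳ-+ k 2 2)) (+-mono-< 2k<N 2k<N)

  1+k≉0 : ¬ (1 , 1) ≋ (0 , 0)
  1+k≉0 (congruent e) = contradiction (trans (sym (m<n⇒m%n≡m 1+k<N)) e) λ ()
    where
    1+k<N : 1 + 1 * k < N
    1+k<N = ≤-<-trans (+-monoˡ-≤ (k + 0) 1≤k) 2k<N

  1≋k⇒k≡1 : (1 , 0) ≋ (0 , 1) → k ≡ 1
  1≋k⇒k≡1 (congruent e) = sym (trans (%-injective-< N 1<N k+0<N e) (+-identityʳ k))
    where
    1<N : 1 < N
    1<N = ≤-trans (s≤s (s≤s z≤n)) 5≤N
    k+0<N : k + 0 < N
    k+0<N = subst (_< N) (sym (+-identityʳ k)) k<N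

  data Step : V → V → Set where
    outer⁺ : ∀ i j → toℕ j ≡ (toℕ i + 1) % N → Step (false , i) (false , j)
    outer⁻ : ∀ i j → toℕ i ≡ (toℕ j + 1) % N → Step (false , i) (false , j)
    inner⁺ : ∀ i j → toℕ j ≡ (toℕ i + k) % N → Step (true , i) (true , j)
    inner⁻ : ∀ i j → toℕ i ≡ (toℕ j + k) % N → Step (true , i) (true , j)
    spoke↑ : ∀ i → Step (false , i) (true , i)
    spoke↓ : ∀ i → Step (true , i) (false , i)

  toStep : ∀ {u v} → Adj u v → Step u v
  toStep (inj₁ (outer i j p)) = outer⁺ i j p
  toStep (inj₁ (spoke i))     = spoke↑ i
  toStep (inj₁ (inner i j p)) = inner⁺ i j p
  toStep (inj₂ (outer i j p)) = outer⁻ j i p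
  toStep (inj₂ (spoke i))     = spoke↓ i
  toStep (inj₂ (inner i j p)) = inner⁻ j i p

  fromStep : ∀ {u v} → Step u v → Adj u v
  fromStep (outer⁺ i j p) = inj₁ (outer i j p)
  fromStep (outer⁻ i j p) = inj₂ (outer j i p)
  fromStep (inner⁺ i j p) = inj₁ (inner i j p)
  fromStep (inner⁻ i j p) = inj₂ (inner j i p)
  fromStep (spoke↑ i)     = inj₁ (spoke i)
  fromStep (spoke↓ i)     = inj₂ (spoke i)

  ahead behind : ∀ {u v} → Step u v → Offset
  ahead (outer⁺ _ _ _) = 1 , 0
  ahead (inner⁺ _ _ _) = 0 , 1
  ahead _              = 0 , 0
  behind (outer⁻ _ _ _) = 1 , 0
  behind (inner⁻ _ _ _) = 0 , 1
  behind _              = 0 , 0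

  reduced-%-congruent : ∀ {y} x {e e′} → e ≡ e′ → y ≡ (x + e) % N → (y + 0) % N ≡ (x + e′) % N
  reduced-%-congruent {y} x {e} refl p = begin
    (y + 0) % N      ≡⟨ cong (_% N) (+-identityʳ y) ⟩
    y % N            ≡⟨ cong (_% N) p ⟩
    (x + e) % N % N  ≡⟨ m%n%n≡m%n (x + e) N ⟩
    (x + e) % N      ∎
    where open ≡-Reasoning

  step-offset : ∀ {b b′ i j} (s : Step (b , i) (b′ , j)) →
                (toℕ i + ⟦ ahead s ⟧) % N ≡ (toℕ j + ⟦ behind s ⟧) % N
  step-offset (outer⁺ i j p) = sym (reduced-%-congruent (toℕ i) refl p)
  step-offset (outer⁻ i j p) = reduced-%-congruent (toℕ j) refl p
  step-offset (inner⁺ i j p) = sym (reduced-%-congruent (toℕ i) (sym (+-identityʳ k)) p)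
  step-offset (inner⁻ i j p) = reduced-%-congruent (toℕ j) (sym (+-identityʳ k)) p
  step-offset (spoke↑ i)     = refl
  step-offset (spoke↓ i)     = refl

  infixr 5 _∷_
  data Walk : V → V → Set where
    []  : ∀ {u} → Walk u u
    _∷_ : ∀ {u v w} → Step u v → Walk v w → Walk u w

  aheadʷ behindʷ : ∀ {u v} → Walk u v → Offset
  aheadʷ []      = 0 , 0
  aheadʷ (s ∷ w) = ahead s ⊕ aheadʷ w
  behindʷ []      = 0 , 0
  behindʷ (s ∷ w) = behind s ⊕ behindʷ w

  walk-offset : ∀ {b b′ i j} (w : Walk (b , i) (b′ , j)) →
                (toℕ i + ⟦ aheadʷ w ⟧) % N ≡ (toℕ j + ⟦ behindʷ w ⟧) % N
  walk-offset [] = refl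
  walk-offset {i = i} {j} (_∷_ {v = _ , l} s w) = begin
    (toℕ i + ⟦ ahead s ⊕ aheadʷ w ⟧) % N  ≡⟨ cong (λ x → (toℕ i + x) % N) (⟦⊕⟧ (ahead s) (aheadʷ w)) ⟩
    (toℕ i + (A + A′)) % N                ≡⟨ cong (_% N) (sym (+-assoc (toℕ i) A A′)) ⟩
    (toℕ i + A + A′) % N                  ≡⟨ +-%-congʳ (toℕ i + A) (toℕ l + B) A′ N (step-offset s) ⟩
    (toℕ l + B + A′) % N                  ≡⟨ cong (_% N) (xy∙z≈xz∙y (toℕ l) B A′) ⟩
    (toℕ l + A′ + B) % N                  ≡⟨ +-%-congʳ (toℕ l + A′) (toℕ j + B′) B N (walk-offset w) ⟩
    (toℕ j + B′ + B) % N                  ≡⟨ cong (_% N) (xy∙z≈x∙zy (toℕ j) B′ B) ⟩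
    (toℕ j + (B + B′)) % N                ≡⟨ cong (λ x → (toℕ j + x) % N) (sym (⟦⊕⟧ (behind s) (behindʷ w))) ⟩
    (toℕ j + ⟦ behind s ⊕ behindʷ w ⟧) % N ∎
    where
    open ≡-Reasoning
    A A′ B B′ : ℕ
    A  = ⟦ ahead s ⟧
    A′ = ⟦ aheadʷ w ⟧
    B  = ⟦ behind s ⟧
    B′ = ⟦ behindʷ w ⟧

  closed-walk : ∀ {u} (w : Walk u u) → aheadʷ w ≋ behindʷ w
  closed-walk {_ , i} w = congruent (+-%-cancelˡ (toℕ i) _ _ N (walk-offset w))

  balanced-walk-returns : ∀ {b i j} (w : Walk (b , i) (b , j)) → aheadʷ w ≡ behindʷ w → (b , i) ≡ (b , j)
  balanced-walk-returns {b} {i} {j} w balanced = cong (b ,_) (Fin.toℕ-injective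
    (%-injective-< N (Fin.toℕ<n i) (Fin.toℕ<n j) (+-%-cancelˡ ⟦ behindʷ w ⟧ _ _ N i+o≡j+o)))
    where
    i+o≡j+o : (⟦ behindʷ w ⟧ + toℕ i) % N ≡ (⟦ behindʷ w ⟧ + toℕ j) % N
    i+o≡j+o = subst₂ (λ x y → x % N ≡ y % N)
      (trans (cong (λ o → toℕ i + ⟦ o ⟧) balanced) (+-comm (toℕ i) _)) (+-comm (toℕ j) _) (walk-offset w)

  adj-irrefl : ∀ {u} → ¬ Adj u u
  adj-irrefl u~u = loop-offsets (toStep u~u) (closed-walk (toStep u~u ∷ []))
    where
    loop-offsets : ∀ {u} (s : Step u u) → aheadʷ (s ∷ []) ≋ behindʷ (s ∷ []) → ⊥
    loop-offsets (outer⁺ _ _ _) e = contradiction (numeral-injective e) λ ()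
    loop-offsets (outer⁻ _ _ _) e = contradiction (numeral-injective e) λ ()
    loop-offsets (inner⁺ _ _ _) e = contradiction (multiple-injective e) λ ()
    loop-offsets (inner⁻ _ _ _) e = contradiction (multiple-injective e) λ ()

  triangle-offsets : ∀ {u v w} (s₀ : Step u v) (s₁ : Step v w) (s₂ : Step w u) →
                     aheadʷ (s₀ ∷ s₁ ∷ s₂ ∷ []) ≋ behindʷ (s₀ ∷ s₁ ∷ s₂ ∷ []) → N ≡ 3 * k
  triangle-offsets (inner⁺ _ _ _) (inner⁺ _ _ _) (inner⁺ _ _ _) e = 3k≋0⇒N≡3k e
  triangle-offsets (inner⁺ _ _ _) (inner⁺ _ _ _) (inner⁻ _ _ _) e = contradiction (multiple-injective e) λ ()
  triangle-offsets (inner⁺ _ _ _) (inner⁻ _ _ _) (inner⁺ _ _ _) e = contradiction (multiple-injective e) λ ()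
  triangle-offsets (inner⁺ _ _ _) (inner⁻ _ _ _) (inner⁻ _ _ _) e = contradiction (multiple-injective e) λ ()
  triangle-offsets (inner⁻ _ _ _) (inner⁺ _ _ _) (inner⁺ _ _ _) e = contradiction (multiple-injective e) λ ()
  triangle-offsets (inner⁻ _ _ _) (inner⁺ _ _ _) (inner⁻ _ _ _) e = contradiction (multiple-injective e) λ ()
  triangle-offsets (inner⁻ _ _ _) (inner⁻ _ _ _) (inner⁺ _ _ _) e = contradiction (multiple-injective e) λ ()
  triangle-offsets (inner⁻ _ _ _) (inner⁻ _ _ _) (inner⁻ _ _ _) e = 3k≋0⇒N≡3k (≋-sym e)
  triangle-offsets (outer⁺ _ _ _) (outer⁺ _ _ _) (outer⁺ _ _ _) e = contradiction (numeral-injective e) λ ()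
  triangle-offsets (outer⁺ _ _ _) (outer⁺ _ _ _) (outer⁻ _ _ _) e = contradiction (numeral-injective e) λ ()
  triangle-offsets (outer⁺ _ _ _) (outer⁻ _ _ _) (outer⁺ _ _ _) e = contradiction (numeral-injective e) λ ()
  triangle-offsets (outer⁺ _ _ _) (outer⁻ _ _ _) (outer⁻ _ _ _) e = contradiction (numeral-injective e) λ ()
  triangle-offsets (outer⁻ _ _ _) (outer⁺ _ _ _) (outer⁺ _ _ _) e = contradiction (numeral-injective e) λ ()
  triangle-offsets (outer⁻ _ _ _) (outer⁺ _ _ _) (outer⁻ _ _ _) e = contradiction (numeral-injective e) λ ()
  triangle-offsets (outer⁻ _ _ _) (outer⁻ _ _ _) (outer⁺ _ _ _) e = contradiction (numeral-injective e) λ ()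
  triangle-offsets (outer⁻ _ _ _) (outer⁻ _ _ _) (outer⁻ _ _ _) e = contradiction (numeral-injective e) λ ()
  triangle-offsets (outer⁺ _ _ _) (spoke↑ _) (spoke↓ _) e = contradiction (numeral-injective e) λ ()
  triangle-offsets (spoke↑ _) (spoke↓ _) (outer⁺ _ _ _) e = contradiction (numeral-injective e) λ ()
  triangle-offsets (spoke↓ _) (outer⁺ _ _ _) (spoke↑ _) e = contradiction (numeral-injective e) λ ()
  triangle-offsets (inner⁺ _ _ _) (spoke↓ _) (spoke↑ _) e = contradiction (multiple-injective e) λ ()
  triangle-offsets (spoke↑ _) (inner⁺ _ _ _) (spoke↓ _) e = contradiction (multiple-injective e) λ ()
  triangle-offsets (spoke↓ _) (spoke↑ _) (inner⁺ _ _ _) e = contradiction (multiple-injective e) λ ()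
  triangle-offsets (outer⁻ _ _ _) (spoke↑ _) (spoke↓ _) e = contradiction (numeral-injective e) λ ()
  triangle-offsets (spoke↑ _) (spoke↓ _) (outer⁻ _ _ _) e = contradiction (numeral-injective e) λ ()
  triangle-offsets (spoke↓ _) (outer⁻ _ _ _) (spoke↑ _) e = contradiction (numeral-injective e) λ ()
  triangle-offsets (inner⁻ _ _ _) (spoke↓ _) (spoke↑ _) e = contradiction (multiple-injective e) λ ()
  triangle-offsets (spoke↑ _) (inner⁻ _ _ _) (spoke↓ _) e = contradiction (multiple-injective e) λ ()
  triangle-offsets (spoke↓ _) (spoke↑ _) (inner⁻ _ _ _) e = contradiction (multiple-injective e) λ ()

  triangle⇒N≡3k : ∀ {u v w} → Adj u v → Adj v w → Adj w u → N ≡ 3 * k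
  triangle⇒N≡3k u~v v~w w~u = triangle-offsets s₀ s₁ s₂ (closed-walk (s₀ ∷ s₁ ∷ s₂ ∷ []))
    where
    s₀ = toStep u~v
    s₁ = toStep v~w
    s₂ = toStep w~u

  -- The wildcard clauses are the walks that turn back at some corner, which would repeat a vertex.
  square-offsets : ∀ {u v w x} (s₀ : Step u v) (s₁ : Step v w) (s₂ : Step w x) (s₃ : Step x u) →
                   u ≢ w → v ≢ x → aheadʷ (s₀ ∷ s₁ ∷ s₂ ∷ s₃ ∷ []) ≋ behindʷ (s₀ ∷ s₁ ∷ s₂ ∷ s₃ ∷ []) →
                   k ≡ 1 ⊎ N ≡ 4 * k
  square-offsets (outer⁺ _ _ _) (outer⁺ _ _ _) (outer⁺ _ _ _) (outer⁺ _ _ _) _ _ e = ⊥-elim (contradiction (numeral-injective e) λ ())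
  square-offsets (outer⁻ _ _ _) (outer⁻ _ _ _) (outer⁻ _ _ _) (outer⁻ _ _ _) _ _ e = ⊥-elim (contradiction (numeral-injective e) λ ())
  square-offsets (inner⁺ _ _ _) (inner⁺ _ _ _) (inner⁺ _ _ _) (inner⁺ _ _ _) _ _ e = inj₂ (4k≋0⇒N≡4k e)
  square-offsets (inner⁻ _ _ _) (inner⁻ _ _ _) (inner⁻ _ _ _) (inner⁻ _ _ _) _ _ e = inj₂ (4k≋0⇒N≡4k (≋-sym e))
  square-offsets (outer⁺ _ _ _) (spoke↑ _) (inner⁺ _ _ _) (spoke↓ _) _ _ e = ⊥-elim (1+k≉0 e)
  square-offsets (spoke↑ _) (inner⁺ _ _ _) (spoke↓ _) (outer⁺ _ _ _) _ _ e = ⊥-elim (1+k≉0 e)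
  square-offsets (inner⁺ _ _ _) (spoke↓ _) (outer⁺ _ _ _) (spoke↑ _) _ _ e = ⊥-elim (1+k≉0 e)
  square-offsets (spoke↓ _) (outer⁺ _ _ _) (spoke↑ _) (inner⁺ _ _ _) _ _ e = ⊥-elim (1+k≉0 e)
  square-offsets (outer⁺ _ _ _) (spoke↑ _) (inner⁻ _ _ _) (spoke↓ _) _ _ e = inj₁ (1≋k⇒k≡1 e)
  square-offsets (spoke↑ _) (inner⁻ _ _ _) (spoke↓ _) (outer⁺ _ _ _) _ _ e = inj₁ (1≋k⇒k≡1 e)
  square-offsets (inner⁻ _ _ _) (spoke↓ _) (outer⁺ _ _ _) (spoke↑ _) _ _ e = inj₁ (1≋k⇒k≡1 e)
  square-offsets (spoke↓ _) (outer⁺ _ _ _) (spoke↑ _) (inner⁻ _ _ _) _ _ e = inj₁ (1≋k⇒k≡1 e)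
  square-offsets (outer⁻ _ _ _) (spoke↑ _) (inner⁺ _ _ _) (spoke↓ _) _ _ e = inj₁ (1≋k⇒k≡1 (≋-sym e))
  square-offsets (spoke↑ _) (inner⁺ _ _ _) (spoke↓ _) (outer⁻ _ _ _) _ _ e = inj₁ (1≋k⇒k≡1 (≋-sym e))
  square-offsets (inner⁺ _ _ _) (spoke↓ _) (outer⁻ _ _ _) (spoke↑ _) _ _ e = inj₁ (1≋k⇒k≡1 (≋-sym e))
  square-offsets (spoke↓ _) (outer⁻ _ _ _) (spoke↑ _) (inner⁺ _ _ _) _ _ e = inj₁ (1≋k⇒k≡1 (≋-sym e))
  square-offsets (outer⁻ _ _ _) (spoke↑ _) (inner⁻ _ _ _) (spoke↓ _) _ _ e = ⊥-elim (1+k≉0 (≋-sym e))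
  square-offsets (spoke↑ _) (inner⁻ _ _ _) (spoke↓ _) (outer⁻ _ _ _) _ _ e = ⊥-elim (1+k≉0 (≋-sym e))
  square-offsets (inner⁻ _ _ _) (spoke↓ _) (outer⁻ _ _ _) (spoke↑ _) _ _ e = ⊥-elim (1+k≉0 (≋-sym e))
  square-offsets (spoke↓ _) (outer⁻ _ _ _) (spoke↑ _) (inner⁻ _ _ _) _ _ e = ⊥-elim (1+k≉0 (≋-sym e))
  square-offsets s₀@(outer⁺ _ _ _) s₁@(outer⁻ _ _ _) _ _ u≢w _ _ = ⊥-elim (u≢w (balanced-walk-returns (s₀ ∷ s₁ ∷ []) refl))
  square-offsets s₀@(outer⁻ _ _ _) s₁@(outer⁺ _ _ _) _ _ u≢w _ _ = ⊥-elim (u≢w (balanced-walk-returns (s₀ ∷ s₁ ∷ []) refl))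
  square-offsets s₀@(inner⁺ _ _ _) s₁@(inner⁻ _ _ _) _ _ u≢w _ _ = ⊥-elim (u≢w (balanced-walk-returns (s₀ ∷ s₁ ∷ []) refl))
  square-offsets s₀@(inner⁻ _ _ _) s₁@(inner⁺ _ _ _) _ _ u≢w _ _ = ⊥-elim (u≢w (balanced-walk-returns (s₀ ∷ s₁ ∷ []) refl))
  square-offsets s₀@(spoke↑ _) s₁@(spoke↓ _) _ _ u≢w _ _ = ⊥-elim (u≢w (balanced-walk-returns (s₀ ∷ s₁ ∷ []) refl))
  square-offsets s₀@(spoke↓ _) s₁@(spoke↑ _) _ _ u≢w _ _ = ⊥-elim (u≢w (balanced-walk-returns (s₀ ∷ s₁ ∷ []) refl))
  square-offsets _ s₁@(outer⁺ _ _ _) s₂@(outer⁻ _ _ _) _ _ v≢x _ = ⊥-elim (v≢x (balanced-walk-returns (s₁ ∷ s₂ ∷ []) refl))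
  square-offsets _ s₁@(outer⁻ _ _ _) s₂@(outer⁺ _ _ _) _ _ v≢x _ = ⊥-elim (v≢x (balanced-walk-returns (s₁ ∷ s₂ ∷ []) refl))
  square-offsets _ s₁@(inner⁺ _ _ _) s₂@(inner⁻ _ _ _) _ _ v≢x _ = ⊥-elim (v≢x (balanced-walk-returns (s₁ ∷ s₂ ∷ []) refl))
  square-offsets _ s₁@(inner⁻ _ _ _) s₂@(inner⁺ _ _ _) _ _ v≢x _ = ⊥-elim (v≢x (balanced-walk-returns (s₁ ∷ s₂ ∷ []) refl))
  square-offsets _ s₁@(spoke↑ _) s₂@(spoke↓ _) _ _ v≢x _ = ⊥-elim (v≢x (balanced-walk-returns (s₁ ∷ s₂ ∷ []) refl))
  square-offsets _ s₁@(spoke↓ _) s₂@(spoke↑ _) _ _ v≢x _ = ⊥-elim (v≢x (balanced-walk-returns (s₁ ∷ s₂ ∷ []) refl))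
  square-offsets _ _ s₂@(outer⁺ _ _ _) s₃@(outer⁻ _ _ _) u≢w _ _ = ⊥-elim (u≢w (sym (balanced-walk-returns (s₂ ∷ s₃ ∷ []) refl)))
  square-offsets _ _ s₂@(outer⁻ _ _ _) s₃@(outer⁺ _ _ _) u≢w _ _ = ⊥-elim (u≢w (sym (balanced-walk-returns (s₂ ∷ s₃ ∷ []) refl)))
  square-offsets _ _ s₂@(inner⁺ _ _ _) s₃@(inner⁻ _ _ _) u≢w _ _ = ⊥-elim (u≢w (sym (balanced-walk-returns (s₂ ∷ s₃ ∷ []) refl)))
  square-offsets _ _ s₂@(inner⁻ _ _ _) s₃@(inner⁺ _ _ _) u≢w _ _ = ⊥-elim (u≢w (sym (balanced-walk-returns (s₂ ∷ s₃ ∷ []) refl)))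
  square-offsets _ _ s₂@(spoke↑ _) s₃@(spoke↓ _) u≢w _ _ = ⊥-elim (u≢w (sym (balanced-walk-returns (s₂ ∷ s₃ ∷ []) refl)))
  square-offsets _ _ s₂@(spoke↓ _) s₃@(spoke↑ _) u≢w _ _ = ⊥-elim (u≢w (sym (balanced-walk-returns (s₂ ∷ s₃ ∷ []) refl)))
  square-offsets s₀@(spoke↓ _) _ _ s₃@(spoke↑ _) _ v≢x _ = ⊥-elim (v≢x (sym (balanced-walk-returns (s₃ ∷ s₀ ∷ []) refl)))
  square-offsets s₀@(spoke↑ _) _ _ s₃@(spoke↓ _) _ v≢x _ = ⊥-elim (v≢x (sym (balanced-walk-returns (s₃ ∷ s₀ ∷ []) refl)))

  square⇒k≡1⊎N≡4k : ∀ {u v w x} → u ≢ w → v ≢ x → Adj u v → Adj v w → Adj w x → Adj x u → k ≡ 1 ⊎ N ≡ 4 * k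
  square⇒k≡1⊎N≡4k u≢w v≢x u~v v~w w~x x~u =
    square-offsets s₀ s₁ s₂ s₃ u≢w v≢x (closed-walk (s₀ ∷ s₁ ∷ s₂ ∷ s₃ ∷ []))
    where
    s₀ = toStep u~v
    s₁ = toStep v~w
    s₂ = toStep w~x
    s₃ = toStep x~u

  _≟ᵛ_ : DecidableEquality V
  _≟ᵛ_ = ≡-dec Bool._≟_ Fin._≟_

  N≡3k⇒¬[k≡1⊎N≡4k] : N ≡ 3 * k → ¬ (k ≡ 1 ⊎ N ≡ 4 * k)
  N≡3k⇒¬[k≡1⊎N≡4k] N≡3k (inj₁ refl) = contradiction (subst (5 ≤_) N≡3k 5≤N) λ { (s≤s (s≤s (s≤s ()))) }
  N≡3k⇒¬[k≡1⊎N≡4k] N≡3k (inj₂ N≡4k) = contradiction (+-cancelʳ-≡ (3 * k) 0 k (trans (sym N≡3k) N≡4k)) (<⇒≢ 1≤k)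

  edges-in-at-most-one-triangle : ∀ {r c y z} → Adj r c → Adj r y → Adj c y → Adj r z → Adj c z → y ≡ z
  edges-in-at-most-one-triangle {r} {c} {y} {z} r~c r~y c~y r~z c~z with y ≟ᵛ z
  ... | yes y≡z = y≡z
  ... | no y≢z  = contradiction (square⇒k≡1⊎N≡4k y≢z r≢c (swap r~y) r~z (swap c~z) c~y)
                                (N≡3k⇒¬[k≡1⊎N≡4k] (triangle⇒N≡3k r~c c~y (swap r~y)))
    where
    r≢c : r ≢ c
    r≢c refl = adj-irrefl r~c

  edge? : Decidable (GPEdge N k)
  edge? (false , i) (false , j) = map′ (outer i j) (λ { (outer _ _ p) → p }) (toℕ j ≟ (toℕ i + 1) % N)
  edge? (false , i) (true , j)  = map′ (λ { refl → spoke i }) (λ { (spoke _) → refl }) (i Fin.≟ j)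
  edge? (true , i)  (false , j) = no λ ()
  edge? (true , i)  (true , j)  = map′ (inner i j) (λ { (inner _ _ p) → p }) (toℕ j ≟ (toℕ i + k) % N)

  adj? : Decidable Adj
  adj? u v = edge? u v ⊎-dec edge? v u

  shift : Fin N → ℕ → Fin N
  shift i e = fromℕ< (m%n<n (toℕ i + e) N)

  toℕ-shift : ∀ i e → toℕ (shift i e) ≡ (toℕ i + e) % N
  toℕ-shift i e = Fin.toℕ-fromℕ< _

  stride : Bool → ℕ
  stride false = 1
  stride true  = k

  0<stride : ∀ b → 0 < stride b
  0<stride false = s≤s z≤n
  0<stride true  = 1≤k

  2·stride<N : ∀ b → stride b + stride b < N
  2·stride<N false = ≤-trans (s≤s (s≤s (s≤s z≤n))) 5≤N
  2·stride<N true  = subst (λ x → k + x < N) (+-identityʳ k) 2k<N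

  stride≤N : ∀ b → stride b ≤ N
  stride≤N b = ≤-trans (m≤m+n (stride b) (stride b)) (<⇒≤ (2·stride<N b))

  shift-back : ∀ b i → (toℕ (shift i (N ∸ stride b)) + stride b) % N ≡ toℕ i
  shift-back b i = begin
    (toℕ (shift i (N ∸ e)) + e) % N  ≡⟨ cong (λ x → (x + e) % N) (toℕ-shift i (N ∸ e)) ⟩
    ((toℕ i + (N ∸ e)) % N + e) % N  ≡⟨ [m%d+n]%d≡[m+n]%d (toℕ i + (N ∸ e)) e N ⟩
    (toℕ i + (N ∸ e) + e) % N        ≡⟨ cong (_% N) (+-assoc (toℕ i) (N ∸ e) e) ⟩
    (toℕ i + (N ∸ e + e)) % N        ≡⟨ cong (λ x → (toℕ i + x) % N) (m∸n+n≡m (stride≤N b)) ⟩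
    (toℕ i + N) % N                  ≡⟨ [m+n]%n≡m%n (toℕ i) N ⟩
    toℕ i % N                        ≡⟨ m<n⇒m%n≡m (Fin.toℕ<n i) ⟩
    toℕ i                            ∎
    where
    open ≡-Reasoning
    e = stride b

  partner successor predecessor : V → V
  partner     (b , i) = not b , i
  successor   (b , i) = b , shift i (stride b)
  predecessor (b , i) = b , shift i (N ∸ stride b)

  partner-step : ∀ v → Step v (partner v)
  partner-step (false , i) = spoke↑ i
  partner-step (true , i)  = spoke↓ i

  successor-step : ∀ v → Step v (successor v)
  successor-step (false , i) = outer⁺ i _ (toℕ-shift i 1)
  successor-step (true , i)  = inner⁺ i _ (toℕ-shift i k)

  predecessor-step : ∀ v → Step (predecessor v) v
  predecessor-step (false , i) = outer⁺ _ i (sym (shift-back false i))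
  predecessor-step (true , i)  = inner⁺ _ i (sym (shift-back true i))

  partner≢successor : ∀ v → partner v ≢ successor v
  partner≢successor (false , _) ()
  partner≢successor (true , _)  ()

  partner≢predecessor : ∀ v → partner v ≢ predecessor v
  partner≢predecessor (false , _) ()
  partner≢predecessor (true , _)  ()

  successor≢predecessor : ∀ v → successor v ≢ predecessor v
  successor≢predecessor (b , i) eq = <⇒≢ (2·stride<N b) (begin
    e + e        ≡⟨ cong (e +_) e≡N∸e ⟩
    e + (N ∸ e)  ≡⟨ m+[n∸m]≡n (stride≤N b) ⟩
    N            ∎)
    where
    open ≡-Reasoning
    e = stride b
    e≡N∸e : e ≡ N ∸ e
    e≡N∸e = %-injective-< N (≤-<-trans (m≤m+n e e) (2·stride<N b)) (∸-monoʳ-< (0<stride b) (stride≤N b))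
      (+-%-cancelˡ (toℕ i) e (N ∸ e) N
        (trans (sym (toℕ-shift i e)) (trans (cong (toℕ ∘ proj₂) eq) (toℕ-shift i (N ∸ e)))))

  neighbours : ∀ v → ThreeNeighbours Adj v
  neighbours v = record
    { n₁ = partner v ; n₂ = successor v ; n₃ = predecessor v
    ; adj₁ = fromStep (partner-step v)
    ; adj₂ = fromStep (successor-step v)
    ; adj₃ = swap (fromStep (predecessor-step v))
    ; n₁≢n₂ = partner≢successor v ; n₁≢n₃ = partner≢predecessor v ; n₂≢n₃ = successor≢predecessor v
    }

mainTheorem4 : (n k : ℕ) → 5 ≤ n → 1 ≤ k → 2 * k < n →
    ¬ GPHasCopNumber n k 1 ×
    (GPHasCopNumber n k 2 → k ≡ 1 ⊎ n ≡ 3 * k ⊎ n ≡ 4 * k)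
mainTheorem4 (suc m) k 5≤n 1≤k 2k<n = one-cop-loses edges-in-at-most-one-triangle ∘ proj₁ , two-cops
  where
  open GeneralizedPetersen m k 5≤n 1≤k 2k<n
  open Evasion _≟ᵛ_ adj? swap adj-irrefl neighbours

  two-cops : GPHasCopNumber (suc m) k 2 → k ≡ 1 ⊎ suc m ≡ 3 * k ⊎ suc m ≡ 4 * k
  two-cops (win , _) with k ≟ 1 | suc m ≟ 3 * k | suc m ≟ 4 * k
  ... | yes k≡1 | _       | _       = inj₁ k≡1
  ... | no _    | yes n≡3k | _      = inj₂ (inj₁ n≡3k)
  ... | no _    | no _    | yes n≡4k = inj₂ (inj₂ n≡4k)
  ... | no k≢1  | no n≢3k | no n≢4k = ⊥-elim (two-cops-lose no-triangle no-square win)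
    where
    no-triangle : TriangleFree
    no-triangle u~v v~w w~u = n≢3k (triangle⇒N≡3k u~v v~w w~u)
    no-square : SquareFree
    no-square u≢w v≢x u~v v~w w~x x~u = [ k≢1 , n≢4k ] (square⇒k≡1⊎N≡4k u≢w v≢x u~v v~w w~x x~u)
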